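{- Let $S_n$ be the star graph on $n\ge 3$ vertices and let $t,r$ be positive integers with $t=r$. If $t=r=1$, then $\gamma_{t,r}(\vec{S_n})=n$ for every orientation $\vec{S_n}$ of $S_n$. If $t=r=2$, then $\mathcal{D}_{t,r}(S_n)=[n-1,n]$.
   Context: The star $S_n$ consists of one central vertex adjacent to $n-1$ leaves. An orientation assigns to every edge exactly one direction. For vertices $u,v$ of an oriented graph, $d(u,v)$ is the minimum length of a directed path from $u$ to $v$ ($d(u,u)=0$; $\infty$ if none exists). Given positive integers $t,r$ and $S\subseteq V$, the directed reception at $w$ is $\vec{r}(w)=\sum_{v\in S,\ d(v,w)<t}(t-d(v,w))$; $S$ is a directed $(t,r)$ broadcast dominating set if $\vec{r}(w)\ge r$ for every vertex $w$, and $\gamma_{t,r}(\vec{G})$ is its minimum cardinality. $\mathcal{D}_{t,r}(G)$ is the integer interval $[d,D]$ where $d$ and $D$ are the minimum and maximum of $\gamma_{t,r}(\vec{G})$ over all orientations $\vec{G}$ of $G$. -}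

module Defs where

open import Data.Nat using (ℕ; zero; suc; _∸_; _≤_; _<ᵇ_; _≡ᵇ_)
open import Data.Bool using (Bool; true; false; _∧_; _∨_; _xor_; not; if_then_else_)
open import Data.Fin using (Fin; toℕ; _≟_)
open import Data.Fin.Subset using (Subset; ∣_∣)
open import Data.Vec using (lookup)
open import Data.List using (List; []; _∷_; allFin; upTo; map)
open import Data.Bool.ListAction using (any)
open import Data.Nat.ListAction using (sum)
open import Data.Maybe using (Maybe; just; nothing)
open import Data.Product using (_×_; Σ; ∃)
open import Relation.Nullary.Decidable using (⌊_⌋)
open import Relation.Binary.PropositionalEquality using (_≡_)

Graph : ℕ → Set
Graph n = Fin n → Fin n → Bool

isCentre : ∀ {n} → Fin n → Bool
isCentre i = toℕ i ≡ᵇ 0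

star : (n : ℕ) → Graph n
star n i j = (isCentre i ∧ not (isCentre j)) ∨ (isCentre j ∧ not (isCentre i))

-- Arc relation of an oriented graph: arc u v = true iff there is an arc u → v.
Digraph : ℕ → Set
Digraph n = Fin n → Fin n → Bool

IsOrientation : ∀ {n} → Graph n → Digraph n → Set
IsOrientation {n} G D = ∀ (i j : Fin n) →
  (G i j ≡ true → (D i j xor D j i) ≡ true) × (G i j ≡ false → D i j ≡ false)

Orientation : ∀ {n} → Graph n → Set
Orientation {n} G = Σ (Digraph n) (IsOrientation G)

reach : ∀ {n} → Digraph n → ℕ → Fin n → Fin n → Bool
reach D zero    u v = ⌊ u ≟ v ⌋
reach {n} D (suc k) u v = reach D k u v ∨ any (λ w → reach D k u w ∧ D w v) (allFin n)

firstTrue : (ℕ → Bool) → List ℕ → Maybe ℕ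
firstTrue p []       = nothing
firstTrue p (k ∷ ks) = if p k then just k else firstTrue p ks

-- Directed distance d(u,v): the minimum length of a directed path from u
-- to v (just d), or nothing (= ∞) if none exists.  A shortest directed
-- path in a digraph on n vertices has length < n, so searching k = 0..n-1
-- suffices.
dist : ∀ {n} → Digraph n → Fin n → Fin n → Maybe ℕ
dist {n} D u v = firstTrue (λ k → reach D k u v) (upTo n)

contrib : ℕ → Maybe ℕ → ℕ
contrib t nothing  = 0
contrib t (just d) = if d <ᵇ t then t ∸ d else 0

reception : ∀ {n} → Digraph n → ℕ → Subset n → Fin n → ℕ
reception {n} D t S w =
  sum (map (λ v → if lookup S v then contrib t (dist D v w) else 0) (allFin n))

IsBroadcastDominating : ∀ {n} → Digraph n → ℕ → ℕ → Subset n → Set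
IsBroadcastDominating {n} D t r S = ∀ (w : Fin n) → r ≤ reception D t S w

IsBroadcastDomNumber : ∀ {n} → Digraph n → ℕ → ℕ → ℕ → Set
IsBroadcastDomNumber {n} D t r m =
  (∃ λ (S : Subset n) → IsBroadcastDominating D t r S × ∣ S ∣ ≡ m)
  × (∀ (S : Subset n) → IsBroadcastDominating D t r S → m ≤ ∣ S ∣)

SpectrumIs : ∀ {n} → Graph n → ℕ → ℕ → ℕ → ℕ → Set
SpectrumIs G t r d D' =
  (∃ λ (o : Orientation G) → IsBroadcastDomNumber (Data.Product.proj₁ o) t r d)
  × (∃ λ (o : Orientation G) → IsBroadcastDomNumber (Data.Product.proj₁ o) t r D')
  × (∀ (o : Orientation G) (m : ℕ) → IsBroadcastDomNumber (Data.Product.proj₁ o) t r m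
       → (d ≤ m) × (m ≤ D'))

{-# OPTIONS --safe #-}
-- A vertex v ≠ w is at directed distance at least 1 from w, and at least 2 unless v → w is an
-- arc; so for t ≤ 2 it sends w at most t − 1, and nothing unless v → w.  For t = r = 1 only w
-- itself can dominate w, forcing S = V.  For t = r = 2 a leaf outside S hears only the centre,
-- at most 1, so every dominating set contains all leaves and n − 1 ≤ γ ≤ n.  Orienting every
-- edge towards the centre the leaves suffice, while orienting every edge away from it nothing
-- reaches the centre, which must then belong to S as well.
module Submission where

open import Defs
open import Data.Nat using (ℕ; zero; suc; _+_; _∸_; _≤_; _<_; _<ᵇ_; z≤n; s≤s)
open import Data.Nat.Properties
  using (≤-refl; ≤-trans; ≤-reflexive; m≤m+n; m≤n+m; +-identityʳ; ∸-monoʳ-≤; n≤0⇒n≡0; ≮⇒≥; ≤⇒≯; module ≤-Reasoning)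
open import Data.Bool using (Bool; true; false; _∧_; _∨_; _xor_; not; if_then_else_)
open import Data.Bool.Properties using (¬-not)
open import Data.Bool.ListAction using (any)
open import Data.Nat.ListAction using (sum)
open import Data.Fin using (Fin; zero; suc; _≟_)
open import Data.Fin.Properties using (suc-injective)
open import Data.Fin.Subset using (Subset; ∣_∣; ⊤; outside)
open import Data.Fin.Subset.Properties using (∣⊤∣≡n; p⊆q⇒∣p∣≤∣q∣)
open import Data.Vec using (lookup; _∷_)
open import Data.Vec.Properties using (lookup⇒[]=; lookup-replicate)
open import Data.List using (List; []; _∷_; map; tabulate; allFin; upTo)
open import Data.List.Properties using (map-tabulate)
open import Data.Maybe using (just)
open import Data.Product using (_×_; _,_; proj₁; proj₂)
open import Data.Empty using (⊥-elim)
open import Relation.Nullary using (yes; no)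
open import Relation.Binary.PropositionalEquality using (_≡_; _≢_; refl; sym; trans; cong; subst; module ≡-Reasoning)
open import Function using (id; _∘_; case_of_)

sum-allFin : ∀ {n} (f : Fin n → ℕ) → sum (map f (allFin n)) ≡ sum (tabulate f)
sum-allFin f = cong sum (map-tabulate id f)

sum-tabulate-zero : ∀ {n} (f : Fin n → ℕ) → (∀ i → f i ≡ 0) → sum (tabulate f) ≡ 0
sum-tabulate-zero {zero}  f _   = refl
sum-tabulate-zero {suc n} f f≡0 rewrite f≡0 zero = sum-tabulate-zero (f ∘ suc) (f≡0 ∘ suc)

sum-tabulate-single : ∀ {n} (f : Fin n → ℕ) i → (∀ j → j ≢ i → f j ≡ 0) → sum (tabulate f) ≡ f i
sum-tabulate-single f zero off =
  trans (cong (f zero +_) (sum-tabulate-zero (f ∘ suc) (λ j → off (suc j) (λ ())))) (+-identityʳ _)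
sum-tabulate-single f (suc i) off rewrite off zero (λ ()) =
  sum-tabulate-single (f ∘ suc) i (λ j j≢i → off (suc j) (j≢i ∘ suc-injective))

≤-sum-tabulate : ∀ {n} (f : Fin n → ℕ) i → f i ≤ sum (tabulate f)
≤-sum-tabulate f zero    = m≤m+n _ _
≤-sum-tabulate f (suc i) = ≤-trans (≤-sum-tabulate (f ∘ suc) i) (m≤n+m _ (f zero))

any-≡-false : ∀ {A : Set} (p : A → Bool) (xs : List A) → (∀ x → p x ≡ false) → any p xs ≡ false
any-≡-false p []       _        = refl
any-≡-false p (x ∷ xs) px≡false rewrite px≡false x = any-≡-false p xs px≡false

contrib-just-≤ : ∀ t {s d} → s ≤ d → contrib t (just d) ≤ t ∸ s
contrib-just-≤ t {d = d} s≤d with d <ᵇ t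
... | true  = ∸-monoʳ-≤ t s≤d
... | false = z≤n

contrib-firstTrue-≤ : ∀ t {s} (p : ℕ → Bool) (ks : List ℕ) →
                      (∀ k → k < s → p k ≡ false) → contrib t (firstTrue p ks) ≤ t ∸ s
contrib-firstTrue-≤ t p []       _     = z≤n
contrib-firstTrue-≤ t p (k ∷ ks) below with p k in pk
... | true  = contrib-just-≤ t (≮⇒≥ λ k<s → case trans (sym pk) (below k k<s) of λ ())
... | false = contrib-firstTrue-≤ t p ks below

dist-refl : ∀ {n} (D : Digraph n) v → dist D v v ≡ just 0
dist-refl {suc n} D v with v ≟ v
... | yes _   = refl
... | no v≢v = ⊥-elim (v≢v refl)

reach₀-≢ : ∀ {n} (D : Digraph n) {v w} → v ≢ w → reach D 0 v w ≡ false
reach₀-≢ D {v} {w} v≢w with v ≟ w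
... | yes v≡w = ⊥-elim (v≢w v≡w)
... | no _    = refl

reach₁-nonArc : ∀ {n} (D : Digraph n) {v w} → v ≢ w → D v w ≡ false → reach D 1 v w ≡ false
reach₁-nonArc {n} D {v} {w} v≢w noArc rewrite reach₀-≢ D v≢w =
  any-≡-false (λ u → reach D 0 v u ∧ D u w) (allFin n) noStep
  where
  noStep : ∀ u → reach D 0 v u ∧ D u w ≡ false
  noStep u with v ≟ u
  ... | yes refl = noArc
  ... | no _     = refl

contrib-dist-≢ : ∀ {n} t (D : Digraph n) {v w} → v ≢ w → contrib t (dist D v w) ≤ t ∸ 1
contrib-dist-≢ {n} t D v≢w = contrib-firstTrue-≤ t {1} _ (upTo n) λ
  { zero    _               → reach₀-≢ D v≢w
  ; (suc _) (s≤s ()) }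

contrib-dist-nonArc : ∀ {n} t (D : Digraph n) {v w} → v ≢ w → D v w ≡ false →
                      contrib t (dist D v w) ≤ t ∸ 2
contrib-dist-nonArc {n} t D v≢w noArc = contrib-firstTrue-≤ t {2} _ (upTo n) λ
  { zero          _                → reach₀-≢ D v≢w
  ; (suc zero)    _                → reach₁-nonArc D v≢w noArc
  ; (suc (suc _)) (s≤s (s≤s ())) }

received : ∀ {n} → Digraph n → ℕ → Subset n → Fin n → Fin n → ℕ
received D t S w v = if lookup S v then contrib t (dist D v w) else 0

module _ {n} (D : Digraph n) (t : ℕ) (S : Subset n) where

  reception≡sum : ∀ w → reception D t S w ≡ sum (tabulate (received D t S w))
  reception≡sum w = sum-allFin (received D t S w)

  reception-single : ∀ w u → (∀ v → v ≢ u → received D t S w v ≡ 0) →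
                     reception D t S w ≡ received D t S w u
  reception-single w u off = trans (reception≡sum w) (sum-tabulate-single _ u off)

  received-∉ : ∀ w v → lookup S v ≡ false → received D t S w v ≡ 0
  received-∉ w v S[v] rewrite S[v] = refl

  received-≤-contrib : ∀ w v → received D t S w v ≤ contrib t (dist D v w)
  received-≤-contrib w v with lookup S v
  ... | true  = ≤-refl
  ... | false = z≤n

  received-≢ : ∀ w v → v ≢ w → received D t S w v ≤ t ∸ 1
  received-≢ w v v≢w = ≤-trans (received-≤-contrib _ _) (contrib-dist-≢ t D v≢w)

  received-nonArc : ∀ w v → v ≢ w → D v w ≡ false → received D t S w v ≤ t ∸ 2
  received-nonArc w v v≢w noArc = ≤-trans (received-≤-contrib _ _) (contrib-dist-nonArc t D v≢w noArc)

received-self : ∀ {n} (D : Digraph n) t S {w} → lookup S w ≡ true → received D (suc t) S w w ≡ suc t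
received-self D t S {w} S[w] rewrite S[w] | dist-refl D w = refl

self-reception : ∀ {n} (D : Digraph n) t S w → lookup S w ≡ true → suc t ≤ reception D (suc t) S w
self-reception D t S w S[w] = begin
  suc t                                    ≡⟨ sym (received-self D t S S[w]) ⟩
  received D (suc t) S w w                 ≤⟨ ≤-sum-tabulate _ w ⟩
  sum (tabulate (received D (suc t) S w))  ≡⟨ sym (reception≡sum D (suc t) S w) ⟩
  reception D (suc t) S w                  ∎
  where open ≤-Reasoning

⊤-dominating : ∀ {n} (D : Digraph n) t → IsBroadcastDominating D (suc t) (suc t) ⊤
⊤-dominating D t w = self-reception D t ⊤ w (lookup-replicate w true)

member-of-dominating : ∀ {n} {D : Digraph n} {t r} S w → IsBroadcastDominating D t (suc r) S →
                       (lookup S w ≡ false → reception D t S w ≤ r) → lookup S w ≡ true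
member-of-dominating S w dom short = ¬-not λ S[w]≡false → ≤⇒≯ (short S[w]≡false) (dom w)

all-in⇒n≤∣S∣ : ∀ {n} (S : Subset n) → (∀ j → lookup S j ≡ true) → n ≤ ∣ S ∣
all-in⇒n≤∣S∣ {n} S all-in =
  subst (_≤ ∣ S ∣) (∣⊤∣≡n n) (p⊆q⇒∣p∣≤∣q∣ {p = ⊤} λ {x} _ → lookup⇒[]= x S (all-in x))

leaves-in⇒n≤∣S∣ : ∀ {n} (S : Subset (suc n)) → (∀ j → lookup S (suc j) ≡ true) → n ≤ ∣ S ∣
leaves-in⇒n≤∣S∣ {n} S leaves-in = subst (_≤ ∣ S ∣) (∣⊤∣≡n n) (p⊆q⇒∣p∣≤∣q∣ {p = outside ∷ ⊤} λ
  { {zero}  ()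
  ; {suc x} _ → lookup⇒[]= (suc x) S (leaves-in x) })

dominating₁₁⇒∈ : ∀ {n} {D : Digraph n} S → IsBroadcastDominating D 1 1 S → ∀ w → lookup S w ≡ true
dominating₁₁⇒∈ {D = D} S dom w = member-of-dominating S w dom λ S[w] → ≤-reflexive (begin
  reception D 1 S w   ≡⟨ reception-single D 1 S w w (λ _ v≢w → n≤0⇒n≡0 (received-≢ D 1 S w _ v≢w)) ⟩
  received D 1 S w w  ≡⟨ received-∉ D 1 S w w S[w] ⟩
  0                   ∎)
  where open ≡-Reasoning

γ₁₁≡n : ∀ {n} (D : Digraph n) → IsBroadcastDomNumber D 1 1 n
γ₁₁≡n {n} D = (⊤ , ⊤-dominating D 0 , ∣⊤∣≡n n) , λ S dom → all-in⇒n≤∣S∣ S (dominating₁₁⇒∈ S dom)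

leaf-noArc : ∀ {n} {D : Digraph (suc n)} → IsOrientation (star (suc n)) D →
             ∀ i j → D (suc i) (suc j) ≡ false
leaf-noArc isO i j = proj₂ (isO (suc i) (suc j)) refl

dominating₂₂⇒leaves : ∀ {n} {D : Digraph (suc n)} → IsOrientation (star (suc n)) D →
                      ∀ S → IsBroadcastDominating D 2 2 S → ∀ j → lookup S (suc j) ≡ true
dominating₂₂⇒leaves {D = D} isO S dom j = member-of-dominating S (suc j) dom λ S[w] → begin
  reception D 2 S (suc j)      ≡⟨ reception-single D 2 S (suc j) zero (onlyCentre S[w]) ⟩
  received D 2 S (suc j) zero  ≤⟨ received-≢ D 2 S (suc j) zero (λ ()) ⟩
  1                            ∎
  where
  open ≤-Reasoning
  onlyCentre : lookup S (suc j) ≡ false → ∀ v → v ≢ zero → received D 2 S (suc j) v ≡ 0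
  onlyCentre S[w] zero    0≢0 = ⊥-elim (0≢0 refl)
  onlyCentre S[w] (suc i) _ = case i ≟ j of λ where
    (yes refl) → received-∉ D 2 S (suc j) (suc j) S[w]
    (no i≢j)   → n≤0⇒n≡0
      (received-nonArc D 2 S (suc j) (suc i) (i≢j ∘ suc-injective) (leaf-noArc isO i j))

γ₂₂-between : ∀ {n} {D : Digraph (suc n)} → IsOrientation (star (suc n)) D →
              ∀ {m} → IsBroadcastDomNumber D 2 2 m → n ≤ m × m ≤ suc n
γ₂₂-between {n} {D} isO {m} ((S , dom , ∣S∣≡m) , minimal) =
  subst (n ≤_) ∣S∣≡m (leaves-in⇒n≤∣S∣ S (dominating₂₂⇒leaves isO S dom)) ,
  subst (m ≤_) (∣⊤∣≡n (suc n)) (minimal ⊤ (⊤-dominating D 1))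

starEdge : Bool → Bool → Bool
starEdge a b = (a ∧ not b) ∨ (b ∧ not a)

-- star n i j is definitionally starEdge (isCentre i) (isCentre j).
orientationByCentre : (arc : Bool → Bool → Bool) →
                      (∀ a b → (starEdge a b ≡ true → (arc a b xor arc b a) ≡ true)
                             × (starEdge a b ≡ false → arc a b ≡ false)) →
                      ∀ {n} → Orientation (star n)
orientationByCentre arc table =
  (λ i j → arc (isCentre i) (isCentre j)) , λ i j → table (isCentre i) (isCentre j)

outStar : ∀ {n} → Orientation (star n)
outStar = orientationByCentre (λ a b → a ∧ not b) λ where
  true  true  → (λ ())      , (λ _ → refl)
  true  false → (λ _ → refl) , (λ ())
  false true  → (λ _ → refl) , (λ _ → refl)
  false false → (λ ())      , (λ _ → refl)

inStar : ∀ {n} → Orientation (star n)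
inStar = orientationByCentre (λ a b → not a ∧ b) λ where
  true  true  → (λ ())      , (λ _ → refl)
  true  false → (λ _ → refl) , (λ _ → refl)
  false true  → (λ _ → refl) , (λ ())
  false false → (λ ())      , (λ _ → refl)

dominating₂₂-outStar⇒centre : ∀ {n} S → IsBroadcastDominating (proj₁ (outStar {suc n})) 2 2 S →
                              lookup S zero ≡ true
dominating₂₂-outStar⇒centre S dom = member-of-dominating S zero dom λ S[0] →
  subst (_≤ 1) (sym (trans (reception-single D 2 S zero zero noLeaf) (received-∉ D 2 S zero zero S[0]))) z≤n
  where
  D = proj₁ outStar
  noLeaf : ∀ v → v ≢ zero → received D 2 S zero v ≡ 0
  noLeaf zero    0≢0 = ⊥-elim (0≢0 refl)
  noLeaf (suc i) i≢0 = n≤0⇒n≡0 (received-nonArc D 2 S zero (suc i) i≢0 refl)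

γ₂₂-outStar : ∀ n → IsBroadcastDomNumber (proj₁ (outStar {suc n})) 2 2 (suc n)
γ₂₂-outStar n = (⊤ , ⊤-dominating _ 1 , ∣⊤∣≡n (suc n)) , λ S dom → all-in⇒n≤∣S∣ S λ where
  zero    → dominating₂₂-outStar⇒centre S dom
  (suc j) → dominating₂₂⇒leaves (proj₂ outStar) S dom j

γ₂₂-inStar : ∀ m → IsBroadcastDomNumber (proj₁ (inStar {3 + m})) 2 2 (2 + m)
γ₂₂-inStar m = (outside ∷ ⊤ , leavesDominate , ∣⊤∣≡n (2 + m)) ,
               λ S dom → leaves-in⇒n≤∣S∣ S (dominating₂₂⇒leaves (proj₂ inStar) S dom)
  where
  leavesDominate : IsBroadcastDominating (proj₁ inStar) 2 2 (outside ∷ ⊤)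
  -- The reception at the centre normalises to 0 + (1 + (1 + _)): leaves 1 and 2 send 1 each.
  leavesDominate zero    = s≤s (s≤s z≤n)
  leavesDominate (suc j) = self-reception _ 1 (outside ∷ ⊤) (suc j) (lookup-replicate j true)

mainTheorem5 : (n : ℕ) → 3 ≤ n →
    ((o : Orientation (star n)) → IsBroadcastDomNumber (proj₁ o) 1 1 n)
    × SpectrumIs (star n) 2 2 (n ∸ 1) n
mainTheorem5 (suc (suc (suc m))) (s≤s (s≤s (s≤s z≤n))) =
  (λ o → γ₁₁≡n (proj₁ o)) ,
  (inStar , γ₂₂-inStar m) ,
  (outStar , γ₂₂-outStar _) ,
  λ o _ γ → γ₂₂-between (proj₂ o) γ
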